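{- Let $G$ be a finite simple graph, let $\mu$ be a positive integer, and let $\mathcal K$ be a clique partition of $\mu G$. Let $c$ be the smallest of the orders of the cliques in $\mathcal K$. For each vertex $u$, let $d_u$ be its degree in $G$ and $e_u$ the number of cliques of order $c$ in $\mathcal K$ that contain $u$. Then $$r_u(\mathcal K)\le\frac{\mu d_u+e_u}{c},$$ with equality if and only if each clique of $\mathcal K$ containing $u$ has order $c$ or $c+1$.
   Context: $\mu G$ is the multigraph obtained from $G$ by replacing each edge by $\mu$ parallel edges. A clique is a complete subgraph with at least two vertices. A clique partition $\mathcal K$ of $\mu G$ is a multiset of cliques of $G$ such that every edge of $G$ lies in exactly $\mu$ of them (counted with multiplicity). $r_u(\mathcal K)$ is the number of cliques of $\mathcal K$ (counted with multiplicity) containing $u$. -}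

module Defs where

open import Data.Nat using (ℕ; _≤_)
open import Data.Bool using (Bool; true; false)
open import Data.Fin using (Fin)
open import Data.Fin.Subset using (Subset; _∈_; ∣_∣)
open import Data.Fin.Subset.Properties using (_∈?_)
open import Data.List using (List; length; filter)
open import Data.Vec using (tabulate)
open import Data.Product using (_×_)
open import Relation.Nullary using (¬_)
open import Relation.Nullary.Decidable using (_×-dec_)
open import Relation.Binary.PropositionalEquality using (_≡_)
open import Data.Nat.Properties using (_≟_)
import Data.List.Membership.Propositional as LM

record SimpleGraph (n : ℕ) : Set where
  field
    adj    : Fin n → Fin n → Bool
    sym    : ∀ u v → adj u v ≡ adj v u
    irrefl : ∀ u → adj u u ≡ false
open SimpleGraph public

degree : ∀ {n} → SimpleGraph n → Fin n → ℕ
degree G u = ∣ tabulate (adj G u) ∣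

IsClique : ∀ {n} → SimpleGraph n → Subset n → Set
IsClique G K = (2 ≤ ∣ K ∣) × (∀ u v → u ∈ K → v ∈ K → ¬ (u ≡ v) → adj G u v ≡ true)

-- Number of cliques of the multiset 𝒦 (a list) containing both u and v.
countPair : ∀ {n} → List (Subset n) → Fin n → Fin n → ℕ
countPair 𝒦 u v = length (filter (λ K → (u ∈? K) ×-dec (v ∈? K)) 𝒦)

IsCliquePartition : ∀ {n} → SimpleGraph n → ℕ → List (Subset n) → Set
IsCliquePartition G μ 𝒦 =
  (∀ K → K LM.∈ 𝒦 → IsClique G K) ×
  (∀ u v → adj G u v ≡ true → countPair 𝒦 u v ≡ μ)

r : ∀ {n} → List (Subset n) → Fin n → ℕ
r 𝒦 u = length (filter (λ K → u ∈? K) 𝒦)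

e : ∀ {n} → List (Subset n) → ℕ → Fin n → ℕ
e 𝒦 c u = length (filter (λ K → (u ∈? K) ×-dec (∣ K ∣ ≟ c)) 𝒦)

IsMinOrder : ∀ {n} → List (Subset n) → ℕ → Set
IsMinOrder 𝒦 c = (Data.Product.∃ λ K → K LM.∈ 𝒦 × ∣ K ∣ ≡ c) × (∀ K → K LM.∈ 𝒦 → c ≤ ∣ K ∣)

{-# OPTIONS --safe #-}
-- Double counting the pairs (K , v) with u , v ∈ K ∈ 𝒦 gives
-- Σ_{K ∋ u} ∣ K ∣ = μ d_u + r_u: each neighbour of u lies together with u in
-- exactly μ cliques, a non-neighbour in none, and u itself in r_u of them.
-- Since every order is at least c, ∣ K ∣ + [ ∣ K ∣ = c ] ≥ c + 1, with equality
-- exactly when ∣ K ∣ ∈ {c , c + 1}; summing over the r_u cliques through u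
-- gives (c + 1) r_u ≤ μ d_u + r_u + e_u, with the same equality condition.
module Submission where

open import Defs hiding (sym)
open import Data.Bool using (Bool; true; false)
open import Data.Fin using (Fin; zero; suc)
open import Data.Fin.Properties using () renaming (_≟_ to _≟ᶠ_)
open import Data.Fin.Subset using (Subset; _∈_; ∣_∣; inside; outside)
open import Data.Fin.Subset.Properties using (_∈?_)
open import Data.List using (List; []; _∷_; length; filter; map)
open import Data.List.Properties using (filter-idem; filter-none)
open import Data.List.Relation.Unary.All as All using (All; []; _∷_)
open import Data.List.Relation.Unary.All.Properties using (filter⁺)
import Data.List.Membership.Propositional as LM
open import Data.List.Membership.Propositional.Properties using (∈-filter⁺; ∈-filter⁻)
open import Data.Nat using (ℕ; suc; _+_; _*_; _≤_; z≤n)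
open import Data.Nat.ListAction using (sum)
open import Data.Nat.Properties
open import Algebra.Properties.CommutativeSemigroup +-commutativeSemigroup
  using () renaming (interchange to +-interchange; xy∙z≈y∙xz to [m+n]+o≡n+[m+o])
open import Algebra.Properties.Semiring.Sum +-*-semiring
  using (sum-syntax; sum-cong-≗; sum-replicate-zero; ∑-distrib-+; *-distribˡ-sum; *-distribʳ-sum)
open import Data.Product using (_×_; _,_; proj₁; proj₂)
open import Data.Sum using (_⊎_; inj₁; inj₂)
open import Data.Vec using (tabulate) renaming (_∷_ to _∷ᵥ_; [] to []ᵥ)
open import Function using (_∘_; _⇔_; mk⇔; Equivalence)
open import Function.Properties.Equivalence using () renaming (trans to ⇔-trans)
open import Relation.Nullary using (Dec; yes; no; does; contradiction; _×-dec_)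
open import Relation.Unary using (Pred; Decidable)
open import Relation.Binary.PropositionalEquality

iverson : Bool → ℕ
iverson true  = 1
iverson false = 0

module _ {a p q} {A : Set a} {P : Pred A p} {Q : Pred A q}
         (P? : Decidable P) (Q? : Decidable Q) where

  filter-×-dec : ∀ xs → filter (λ x → P? x ×-dec Q? x) xs ≡ filter Q? (filter P? xs)
  filter-×-dec [] = refl
  filter-×-dec (x ∷ xs) with does (P? x)
  ... | false = filter-×-dec xs
  ... | true with does (Q? x)
  ...   | true  = cong (x ∷_) (filter-×-dec xs)
  ...   | false = filter-×-dec xs

module _ {a p q} {A : Set a} {P : Pred A p} {Q : Pred A q} (P? : Decidable P) where

  All-filter⇔ : ∀ xs → All Q (filter P? xs) ⇔ (∀ x → x LM.∈ xs → P x → Q x)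
  All-filter⇔ xs = mk⇔
    (λ all x x∈xs px → All.lookup all (∈-filter⁺ P? x∈xs px))
    (λ h → All.tabulate λ x∈ → let x∈xs , px = ∈-filter⁻ P? x∈ in h _ x∈xs px)

length-filter-∷ : ∀ {a p} {A : Set a} {P : Pred A p} (P? : Decidable P) x xs →
  length (filter P? (x ∷ xs)) ≡ iverson (does (P? x)) + length (filter P? xs)
length-filter-∷ P? x xs with does (P? x)
... | true  = refl
... | false = refl

+-split-≡ : ∀ {a b c d} → a ≤ b → c ≤ d → a + c ≡ b + d → a ≡ b × c ≡ d
+-split-≡ {a} {b} {c} {d} a≤b c≤d eq = a≡b , +-cancelˡ-≡ a c d (trans eq (cong (_+ d) (sym a≡b)))
  where
  a≡b : a ≡ b
  a≡b = ≤-antisym a≤b (+-cancelʳ-≤ d b a (≤-trans (≤-reflexive (sym eq)) (+-monoʳ-≤ a c≤d)))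

-- Stated for an arbitrary decision of k ≡ c, because does (k ≟ c) computes to
-- k ≡ᵇ c and would escape a with-abstraction over k ≟ c.
suc≤+iverson : ∀ {c k} (k≟c : Dec (k ≡ c)) → c ≤ k → suc c ≤ k + iverson (does k≟c)
suc≤+iverson {k = k} (yes refl) _   = ≤-reflexive (+-comm 1 k)
suc≤+iverson {k = k} (no k≢c)   c≤k = ≤-trans (≤∧≢⇒< c≤k (k≢c ∘ sym)) (≤-reflexive (sym (+-identityʳ k)))

suc≡+iverson⇔ : ∀ {c k} (k≟c : Dec (k ≡ c)) → (suc c ≡ k + iverson (does k≟c)) ⇔ (k ≡ c ⊎ k ≡ suc c)
suc≡+iverson⇔ {k = k} (yes refl) = mk⇔ (λ _ → inj₁ refl) (λ _ → +-comm 1 k)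
suc≡+iverson⇔ {k = k} (no k≢c)   = mk⇔ (λ eq → inj₂ (sym (trans eq (+-identityʳ k))))
  λ { (inj₁ k≡c)   → contradiction k≡c k≢c
    ; (inj₂ k≡1+c) → trans (sym k≡1+c) (sym (+-identityʳ k)) }

module _ {a} {A : Set a} (size : A → ℕ) (c : ℕ) where

  sum+count : List A → ℕ
  sum+count xs = sum (map size xs) + length (filter ((_≟ c) ∘ size) xs)

  private
    sum+count-∷ : ∀ x xs → sum+count (x ∷ xs) ≡ (size x + iverson (does (size x ≟ c))) + sum+count xs
    sum+count-∷ x xs = begin
      (size x + sum (map size xs)) + length (filter ((_≟ c) ∘ size) (x ∷ xs))
        ≡⟨ cong ((size x + sum (map size xs)) +_) (length-filter-∷ ((_≟ c) ∘ size) x xs) ⟩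
      (size x + sum (map size xs)) + (iverson (does (size x ≟ c)) + length (filter ((_≟ c) ∘ size) xs))
        ≡⟨ +-interchange (size x) _ _ _ ⟩
      (size x + iverson (does (size x ≟ c))) + sum+count xs ∎
      where open ≡-Reasoning

  length*suc≤sum+count : ∀ xs → All (λ x → c ≤ size x) xs → length xs * suc c ≤ sum+count xs
  length*suc≤sum+count []       []        = z≤n
  length*suc≤sum+count (x ∷ xs) (c≤x ∷ h) = ≤-trans
    (+-mono-≤ (suc≤+iverson (size x ≟ c) c≤x) (length*suc≤sum+count xs h))
    (≤-reflexive (sym (sum+count-∷ x xs)))

  length*suc≡sum+count⇔ : ∀ xs → All (λ x → c ≤ size x) xs →
    (length xs * suc c ≡ sum+count xs) ⇔ All (λ x → size x ≡ c ⊎ size x ≡ suc c) xs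
  length*suc≡sum+count⇔ []       []        = mk⇔ (λ _ → []) (λ _ → refl)
  length*suc≡sum+count⇔ (x ∷ xs) (c≤x ∷ h) = mk⇔
    (λ eq → let head≡ , tail≡ = +-split-≡ (suc≤+iverson (size x ≟ c) c≤x) (length*suc≤sum+count xs h)
                                          (trans eq (sum+count-∷ x xs))
            in Equivalence.to (suc≡+iverson⇔ (size x ≟ c)) head≡ ∷ Equivalence.to ih tail≡)
    (λ { (px ∷ pxs) → trans (cong₂ _+_ (Equivalence.from (suc≡+iverson⇔ (size x ≟ c)) px) (Equivalence.from ih pxs))
                            (sym (sum+count-∷ x xs)) })
    where ih = length*suc≡sum+count⇔ xs h

∣p∣≡∑ : ∀ {n} (p : Subset n) → ∣ p ∣ ≡ ∑[ v < n ] iverson (does (v ∈? p))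
∣p∣≡∑ []ᵥ            = refl
∣p∣≡∑ (inside  ∷ᵥ p) = cong suc (∣p∣≡∑ p)
∣p∣≡∑ (outside ∷ᵥ p) = ∣p∣≡∑ p

∣tabulate∣≡∑ : ∀ {n} (f : Fin n → Bool) → ∣ tabulate f ∣ ≡ ∑[ v < n ] iverson (f v)
∣tabulate∣≡∑ {0}     f = refl
∣tabulate∣≡∑ {suc n} f with f zero
... | true  = cong suc (∣tabulate∣≡∑ (f ∘ suc))
... | false = ∣tabulate∣≡∑ (f ∘ suc)

∑-iverson-≟ : ∀ {n} (u : Fin n) → ∑[ v < n ] iverson (does (u ≟ᶠ v)) ≡ 1
∑-iverson-≟ {suc n} zero    = cong suc (sum-replicate-zero n)
∑-iverson-≟ {suc n} (suc u) = ∑-iverson-≟ u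

sum-map-∣∣≡∑-length-filter : ∀ {n} (Ks : List (Subset n)) →
  sum (map ∣_∣ Ks) ≡ ∑[ v < n ] length (filter (v ∈?_) Ks)
sum-map-∣∣≡∑-length-filter {n} []       = sym (sum-replicate-zero n)
sum-map-∣∣≡∑-length-filter {n} (K ∷ Ks) = begin
  ∣ K ∣ + sum (map ∣_∣ Ks)
    ≡⟨ cong₂ _+_ (∣p∣≡∑ K) (sum-map-∣∣≡∑-length-filter Ks) ⟩
  (∑[ v < n ] iverson (does (v ∈? K))) + (∑[ v < n ] length (filter (v ∈?_) Ks))
    ≡⟨ ∑-distrib-+ (λ v → iverson (does (v ∈? K))) (λ v → length (filter (v ∈?_) Ks)) ⟨
  ∑[ v < n ] (iverson (does (v ∈? K)) + length (filter (v ∈?_) Ks))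
    ≡⟨ sum-cong-≗ (λ v → length-filter-∷ (v ∈?_) K Ks) ⟨
  ∑[ v < n ] length (filter (v ∈?_) (K ∷ Ks)) ∎
  where open ≡-Reasoning

module _ {n} (G : SimpleGraph n) (μ : ℕ) (𝒦 : List (Subset n)) (u : Fin n) where

  countPair≡length-filter : ∀ v → countPair 𝒦 u v ≡ length (filter (v ∈?_) (filter (u ∈?_) 𝒦))
  countPair≡length-filter v = cong length (filter-×-dec (u ∈?_) (v ∈?_) 𝒦)

  countPair-self : countPair 𝒦 u u ≡ r 𝒦 u
  countPair-self = trans (countPair≡length-filter u) (cong length (filter-idem (u ∈?_) 𝒦))

  countPair-nonadjacent : (∀ K → K LM.∈ 𝒦 → IsClique G K) → ∀ {v} → u ≢ v → adj G u v ≡ false →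
    countPair 𝒦 u v ≡ 0
  countPair-nonadjacent cliques {v} u≢v nonadjacent =
    cong length (filter-none (λ K → (u ∈? K) ×-dec (v ∈? K)) (All.tabulate λ {K} K∈𝒦 (u∈K , v∈K) →
      contradiction (trans (sym (proj₂ (cliques K K∈𝒦) u v u∈K v∈K u≢v)) nonadjacent) λ ()))

  module _ (P : IsCliquePartition G μ 𝒦) where

    countPair-partition : ∀ v → countPair 𝒦 u v ≡ μ * iverson (adj G u v) + iverson (does (u ≟ᶠ v)) * r 𝒦 u
    countPair-partition v with u ≟ᶠ v
    ... | yes refl rewrite irrefl G u | *-zeroʳ μ | +-identityʳ (r 𝒦 u) = countPair-self
    ... | no u≢v with adj G u v in adjacency
    ...   | true  rewrite *-identityʳ μ | +-identityʳ μ = proj₂ P u v adjacency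
    ...   | false rewrite *-zeroʳ μ = countPair-nonadjacent (proj₁ P) u≢v adjacency

    ∑-countPair : ∑[ v < n ] countPair 𝒦 u v ≡ μ * degree G u + r 𝒦 u
    ∑-countPair = begin
      ∑[ v < n ] countPair 𝒦 u v
        ≡⟨ sum-cong-≗ countPair-partition ⟩
      ∑[ v < n ] (μ * iverson (adj G u v) + iverson (does (u ≟ᶠ v)) * r 𝒦 u)
        ≡⟨ ∑-distrib-+ (λ v → μ * iverson (adj G u v)) (λ v → iverson (does (u ≟ᶠ v)) * r 𝒦 u) ⟩
      (∑[ v < n ] (μ * iverson (adj G u v))) + (∑[ v < n ] (iverson (does (u ≟ᶠ v)) * r 𝒦 u))
        ≡⟨ cong₂ _+_ (*-distribˡ-sum μ (iverson ∘ adj G u)) (*-distribʳ-sum (r 𝒦 u) (iverson ∘ does ∘ (u ≟ᶠ_))) ⟨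
      μ * (∑[ v < n ] iverson (adj G u v)) + (∑[ v < n ] iverson (does (u ≟ᶠ v))) * r 𝒦 u
        ≡⟨ cong₂ (λ d δ → μ * d + δ * r 𝒦 u) (sym (∣tabulate∣≡∑ (adj G u))) (∑-iverson-≟ u) ⟩
      μ * degree G u + 1 * r 𝒦 u
        ≡⟨ cong (μ * degree G u +_) (*-identityˡ (r 𝒦 u)) ⟩
      μ * degree G u + r 𝒦 u ∎
      where open ≡-Reasoning

    sum-orders≡μ*degree+r : sum (map ∣_∣ (filter (u ∈?_) 𝒦)) ≡ μ * degree G u + r 𝒦 u
    sum-orders≡μ*degree+r = begin
      sum (map ∣_∣ (filter (u ∈?_) 𝒦))                        ≡⟨ sum-map-∣∣≡∑-length-filter (filter (u ∈?_) 𝒦) ⟩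
      ∑[ v < n ] length (filter (v ∈?_) (filter (u ∈?_) 𝒦))  ≡⟨ sum-cong-≗ countPair≡length-filter ⟨
      ∑[ v < n ] countPair 𝒦 u v                              ≡⟨ ∑-countPair ⟩
      μ * degree G u + r 𝒦 u                                  ∎
      where open ≡-Reasoning

lemma3 : ∀ {n} (G : SimpleGraph n) (μ : ℕ) (𝒦 : List (Subset n)) (c : ℕ) →
    1 ≤ μ → IsCliquePartition G μ 𝒦 → IsMinOrder 𝒦 c → (u : Fin n) →
    (c * r 𝒦 u ≤ μ * degree G u + e 𝒦 c u) ×
    ((c * r 𝒦 u ≡ μ * degree G u + e 𝒦 c u) ⇔
      (∀ K → K LM.∈ 𝒦 → u ∈ K → (∣ K ∣ ≡ c ⊎ ∣ K ∣ ≡ suc c)))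
lemma3 {n} G μ 𝒦 c _ P (_ , c≤orders) u =
  +-cancelˡ-≤ (r 𝒦 u) _ _ (subst₂ _≤_ lhs≡ rhs≡ (length*suc≤sum+count ∣_∣ c 𝒦ᵤ c≤orders-at-u)) ,
  ⇔-trans cancel-r (⇔-trans (length*suc≡sum+count⇔ ∣_∣ c 𝒦ᵤ c≤orders-at-u) (All-filter⇔ (u ∈?_) 𝒦))
  where
  𝒦ᵤ : List (Subset n)
  𝒦ᵤ = filter (u ∈?_) 𝒦

  c≤orders-at-u : All (λ K → c ≤ ∣ K ∣) 𝒦ᵤ
  c≤orders-at-u = filter⁺ (u ∈?_) (All.tabulate (c≤orders _))

  lhs≡ : length 𝒦ᵤ * suc c ≡ r 𝒦 u + c * r 𝒦 u
  lhs≡ = trans (*-suc (r 𝒦 u) c) (cong (r 𝒦 u +_) (*-comm (r 𝒦 u) c))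

  rhs≡ : sum+count ∣_∣ c 𝒦ᵤ ≡ r 𝒦 u + (μ * degree G u + e 𝒦 c u)
  rhs≡ = trans (cong₂ _+_ (sum-orders≡μ*degree+r G μ 𝒦 u P)
                          (sym (cong length (filter-×-dec (u ∈?_) ((_≟ c) ∘ ∣_∣) 𝒦))))
               ([m+n]+o≡n+[m+o] (μ * degree G u) (r 𝒦 u) (e 𝒦 c u))

  cancel-r : (c * r 𝒦 u ≡ μ * degree G u + e 𝒦 c u) ⇔ (length 𝒦ᵤ * suc c ≡ sum+count ∣_∣ c 𝒦ᵤ)
  cancel-r = mk⇔ (λ eq → trans lhs≡ (trans (cong (r 𝒦 u +_) eq) (sym rhs≡)))
                 (λ eq → +-cancelˡ-≡ (r 𝒦 u) _ _ (trans (sym lhs≡) (trans eq rhs≡)))
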